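{- Let $k\ge1$ and $1\le h\le k$. Let $C_k(x)=\sum_{n\ge0}c_{n,k}x^n$, where $c_{n,k}$ is the number of words $w=w_1\cdots w_n$ on $\{1,\dots,k\}$ in which every letter of $\{1,\dots,k\}$ occurs, which avoid both generalized patterns $1-11$ and $1-12$, and whose last letter $w_n$ occurs nowhere else in $w$. Let $C_k^{(h)}(x)=\sum_{n\ge0}c^{(h)}_{n,k}x^n$, where $c^{(h)}_{n,k}$ is the number of words $w=w_1\cdots w_n$ on $\{1,\dots,k\}$ in which every letter of $\{1,\dots,k\}$ occurs, which avoid both $1-11$ and $1-12$, and which end with the letter $h$ (i.e. $w_n=h$) where $h$ also occurs in some earlier position. Then \[ C_k^{(h)}(x)=x(1+x)^{k-h}C_k(x). \]
   Context: Words are finite sequences over a totally ordered alphabet $\{1,\dots,k\}$. A word $w$ contains the generalized pattern $1-11$ iff there exist indices $1\le i<j<n$ with $w_i=w_j=w_{j+1}$, and contains $1-12$ iff there exist $i<j<n$ with $w_i=w_j<w_{j+1}$; it avoids a pattern if it does not contain it. -}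

module Defs where

open import Data.Nat using (ℕ; zero; suc; _+_; _*_; _∸_; _<_)
import Data.Nat as ℕ
open import Data.Nat.Combinatorics using (_C_)
open import Data.Fin using (Fin; toℕ; _≟_)
open import Data.Fin.Properties using (any?; all?)
open import Data.Vec using (Vec; []; _∷_; lookup)
open import Data.List using (List; [_]; concatMap; map; length; filter; upTo; allFin)
open import Data.Nat.ListAction using (sum)
open import Data.Product using (Σ; ∃; _×_; _,_)
open import Relation.Binary.PropositionalEquality using (_≡_; _≢_)
open import Relation.Nullary using (Dec; ¬_; yes; no)
open import Relation.Nullary.Decidable using (_×-dec_; ¬?; _→-dec_)

-- Words of length n on the alphabet {1,…,k}, encoded as Vec (Fin k) n
-- (letter a ∈ {1,…,k} is the element a-1 of Fin k; positions are 0-based).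
Word : ℕ → ℕ → Set
Word k n = Vec (Fin k) n

AllLetters : ∀ {k n} → Word k n → Set
AllLetters {k} {n} w = (a : Fin k) → ∃ λ (i : Fin n) → lookup w i ≡ a

Contains1-11 : ∀ {k n} → Word k n → Set
Contains1-11 {k} {n} w =
  ∃ λ (i : Fin n) → ∃ λ (j : Fin n) → ∃ λ (j' : Fin n) →
    (toℕ i < toℕ j) × (toℕ j' ≡ suc (toℕ j)) ×
    (lookup w i ≡ lookup w j) × (lookup w j ≡ lookup w j')

Contains1-12 : ∀ {k n} → Word k n → Set
Contains1-12 {k} {n} w =
  ∃ λ (i : Fin n) → ∃ λ (j : Fin n) → ∃ λ (j' : Fin n) →
    (toℕ i < toℕ j) × (toℕ j' ≡ suc (toℕ j)) ×
    (lookup w i ≡ lookup w j) × (toℕ (lookup w j) < toℕ (lookup w j'))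

-- the last letter occurs nowhere else (false for the empty word)
LastUnique : ∀ {k n} → Word k n → Set
LastUnique {k} {n} w =
  ∃ λ (l : Fin n) → (suc (toℕ l) ≡ n) ×
    ((i : Fin n) → i ≢ l → lookup w i ≢ lookup w l)

EndsWithRepeated : ∀ {k n} → Fin k → Word k n → Set
EndsWithRepeated {k} {n} h w =
  ∃ λ (l : Fin n) → (suc (toℕ l) ≡ n) × (lookup w l ≡ h) ×
    (∃ λ (i : Fin n) → (toℕ i < toℕ l) × (lookup w i ≡ h))

IsC : ∀ {k n} → Word k n → Set
IsC w = AllLetters w × ¬ Contains1-11 w × ¬ Contains1-12 w × LastUnique w

IsCh : ∀ {k n} → Fin k → Word k n → Set
IsCh h w = AllLetters w × ¬ Contains1-11 w × ¬ Contains1-12 w × EndsWithRepeated h w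

allLetters? : ∀ {k n} (w : Word k n) → Dec (AllLetters w)
allLetters? w = all? λ a → any? λ i → lookup w i ≟ a

contains1-11? : ∀ {k n} (w : Word k n) → Dec (Contains1-11 w)
contains1-11? w = any? λ i → any? λ j → any? λ j' →
  (toℕ i ℕ.<? toℕ j) ×-dec (toℕ j' ℕ.≟ suc (toℕ j)) ×-dec
  (lookup w i ≟ lookup w j) ×-dec (lookup w j ≟ lookup w j')

contains1-12? : ∀ {k n} (w : Word k n) → Dec (Contains1-12 w)
contains1-12? w = any? λ i → any? λ j → any? λ j' →
  (toℕ i ℕ.<? toℕ j) ×-dec (toℕ j' ℕ.≟ suc (toℕ j)) ×-dec
  (lookup w i ≟ lookup w j) ×-dec (toℕ (lookup w j) ℕ.<? toℕ (lookup w j'))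

lastUnique? : ∀ {k n} (w : Word k n) → Dec (LastUnique w)
lastUnique? {n = n} w = any? λ l → (suc (toℕ l) ℕ.≟ n) ×-dec
  all? (λ i → ¬? (i ≟ l) →-dec ¬? (lookup w i ≟ lookup w l))

endsWithRepeated? : ∀ {k n} (h : Fin k) (w : Word k n) → Dec (EndsWithRepeated h w)
endsWithRepeated? {n = n} h w = any? λ l → (suc (toℕ l) ℕ.≟ n) ×-dec
  (lookup w l ≟ h) ×-dec any? (λ i → (toℕ i ℕ.<? toℕ l) ×-dec (lookup w i ≟ h))

isC? : ∀ {k n} (w : Word k n) → Dec (IsC w)
isC? w = allLetters? w ×-dec ¬? (contains1-11? w) ×-dec ¬? (contains1-12? w) ×-dec lastUnique? w

isCh? : ∀ {k n} (h : Fin k) (w : Word k n) → Dec (IsCh h w)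
isCh? h w = allLetters? w ×-dec ¬? (contains1-11? w) ×-dec ¬? (contains1-12? w) ×-dec endsWithRepeated? h w

allWords : (k n : ℕ) → List (Word k n)
allWords k zero = [ [] ]
allWords k (suc n) = concatMap (λ a → map (a ∷_) (allWords k n)) (allFin k)

c : (k n : ℕ) → ℕ
c k n = length (filter isC? (allWords k n))

ch : (k : ℕ) → Fin k → ℕ → ℕ
ch k h n = length (filter (isCh? h) (allWords k n))

-- coefficient sequences of formal power series; Cauchy product
_⊛_ : (ℕ → ℕ) → (ℕ → ℕ) → (ℕ → ℕ)
(f ⊛ g) n = sum (map (λ i → f i * g (n ∸ i)) (upTo (suc n)))

x[1+x]^ : ℕ → ℕ → ℕ
x[1+x]^ e zero = 0
x[1+x]^ e (suc m) = e C m

module Submission where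

-- Write a word ending in a repeated letter h as v h.  For v = u b (b the last
-- letter of v) the word v h is counted by c^(h) exactly when either
--   * v is counted by c (its last letter b is new), or
--   * h < b and v is counted by c^(b) (b is repeated, so avoiding 1-11 and 1-12
--     forces the next letter below b).
-- Counting these cases gives, for every n,
--   c^(h)_{n+1} = c_n + Σ_{t > h} c^(t)_n ,   c^(h)_0 = 0.              (★)
-- On the other side, the coefficients of x(1+x)^e C(x) satisfy Pascal's rule in
-- e, which telescopes to the same recurrence (★) with e = k - h.  Since (★)
-- determines all c^(h)_n from the c_n, induction on n proves the theorem.

open import Defs
open import Data.Nat using (ℕ; zero; suc; _+_; _*_; _∸_; _<_; z<s; s<s)
open import Data.Nat.Properties
  using (+-*-semiring; +-assoc; +-comm; +-identityʳ; *-identityˡ; *-distribʳ-+; <-irrefl; <-asym; <-cmp)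
import Data.Nat.Properties as ℕₚ
open import Data.Nat.Combinatorics using (_C_; nCk+nC[k+1]≡[n+1]C[k+1])
open import Data.Nat.ListAction using () renaming (sum to listSum)
open import Data.Nat.ListAction.Properties using (sum-++)
open import Data.Fin using (Fin; zero; suc; toℕ; inject₁; fromℕ)
open import Data.Fin.Properties
  using (any?; suc-injective; toℕ<n; toℕ-inject₁; toℕ-fromℕ; toℕ-injective; fromℕ≢inject₁; toℕ-inject₁-≢)
  renaming (_≟_ to _≟ᶠ_)
open import Data.Fin.Relation.Unary.Top using (view; ‵fromℕ; ‵inject₁)
open import Data.Vec using (Vec; []; _∷_; lookup; _∷ʳ_; initLast)
open import Data.List using (List; []; _∷_; _++_; map; concatMap; length; filter; applyUpTo; tabulate)
open import Data.List.Properties using (map-++; map-∘)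
open import Data.Product using (∃; ∃₂; _×_; _,_; proj₁; proj₂)
open import Data.Sum using (_⊎_; inj₁; inj₂)
open import Data.Empty using (⊥-elim)
open import Function using (_∘_)
open import Relation.Binary.Definitions using (tri<; tri≈; tri>)
open import Relation.Binary.PropositionalEquality
open import Relation.Nullary using (Dec; yes; no; ¬_)
open import Relation.Unary using (Decidable)
open import Algebra.Properties.Semiring.Sum +-*-semiring
  using (sum; sum-cong-≗; sum-replicate-zero; ∑-distrib-+; ∑-comm)

open ≡-Reasoning

private
  variable
    k m n : ℕ

sum-zero : (f : Fin n → ℕ) → (∀ i → f i ≡ 0) → sum f ≡ 0
sum-zero {n} f f≡0 = trans (sum-cong-≗ f≡0) (sum-replicate-zero n)

sum-single : (f : Fin n → ℕ) (b : Fin n) → (∀ i → i ≢ b → f i ≡ 0) → sum f ≡ f b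
sum-single f zero off =
  trans (cong (f zero +_) (sum-zero (f ∘ suc) (λ i → off (suc i) λ ()))) (+-identityʳ (f zero))
sum-single f (suc b) off =
  cong₂ _+_ (off zero λ ()) (sum-single (f ∘ suc) b (λ i i≢b → off (suc i) (i≢b ∘ suc-injective)))

sumAbove : Fin k → (Fin k → ℕ) → ℕ
sumAbove zero    f = sum (f ∘ suc)
sumAbove (suc h) f = sumAbove h (f ∘ suc)

sumAbove-cong : (h : Fin k) {f g : Fin k → ℕ} → (∀ t → f t ≡ g t) → sumAbove h f ≡ sumAbove h g
sumAbove-cong zero    f≗g = sum-cong-≗ (f≗g ∘ suc)
sumAbove-cong (suc h) f≗g = sumAbove-cong h (f≗g ∘ suc)

sumAbove-zero : (h : Fin k) (f : Fin k → ℕ) → (∀ t → toℕ h < toℕ t → f t ≡ 0) → sumAbove h f ≡ 0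
sumAbove-zero zero    f f≡0 = sum-zero (f ∘ suc) (λ t → f≡0 (suc t) z<s)
sumAbove-zero (suc h) f f≡0 = sumAbove-zero h (f ∘ suc) (λ t h<t → f≡0 (suc t) (s<s h<t))

sumAbove-single : (h b : Fin k) (f : Fin k → ℕ) → toℕ h < toℕ b → (∀ t → t ≢ b → f t ≡ 0) →
  sumAbove h f ≡ f b
sumAbove-single zero    (suc b) f _         off =
  sum-single (f ∘ suc) b (λ t t≢b → off (suc t) (t≢b ∘ suc-injective))
sumAbove-single (suc h) (suc b) f (s<s h<b) off =
  sumAbove-single h b (f ∘ suc) h<b (λ t t≢b → off (suc t) (t≢b ∘ suc-injective))

-- The series side: coefficients of x(1+x)^e A(x)

-- A list sum over applyUpTo is a sum over Fin; this reads the convolution ⊛ as a Fin-sum.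
listSum-applyUpTo : ∀ n (f g : ℕ → ℕ) → listSum (map g (applyUpTo f n)) ≡ sum (λ (i : Fin n) → g (f (toℕ i)))
listSum-applyUpTo zero    f g = refl
listSum-applyUpTo (suc n) f g = cong (g (f 0) +_) (listSum-applyUpTo n (f ∘ suc) g)

module _ (a : ℕ → ℕ) where

  -- binomialConv e n = Σ_{i ≤ n} (e choose i) a_{n-i}, the coefficient of x^(n+1)
  -- in x(1+x)^e A(x).
  binomialConv : ℕ → ℕ → ℕ
  binomialConv e n = sum (λ (i : Fin (suc n)) → (e C toℕ i) * a (n ∸ toℕ i))

  series-suc≡binomialConv : ∀ e n → (x[1+x]^ e ⊛ a) (suc n) ≡ binomialConv e n
  series-suc≡binomialConv e n = listSum-applyUpTo (suc (suc n)) (λ i → i) (λ i → x[1+x]^ e i * a (suc n ∸ i))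

  -- Pascal's rule: x(1+x)^(e+1) A = x(1+x)^e A + x · x(1+x)^e A.
  binomialConv-pascal : ∀ e n → binomialConv (suc e) n ≡ binomialConv e n + (x[1+x]^ e ⊛ a) n
  binomialConv-pascal e zero    = sym (+-identityʳ _)
  binomialConv-pascal e (suc m) = begin
    a₀ + sum (λ (i : Fin (suc m)) → (suc e C suc (toℕ i)) * a (m ∸ toℕ i))
      ≡⟨ cong (a₀ +_) (sum-cong-≗ pascal) ⟩
    a₀ + sum (λ (i : Fin (suc m)) → (e C toℕ i) * a (m ∸ toℕ i) + (e C suc (toℕ i)) * a (m ∸ toℕ i))
      ≡⟨ cong (a₀ +_) (∑-distrib-+ {suc m} (λ i → (e C toℕ i) * a (m ∸ toℕ i)) (λ i → (e C suc (toℕ i)) * a (m ∸ toℕ i))) ⟩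
    a₀ + (binomialConv e m + S)
      ≡⟨ cong (a₀ +_) (+-comm (binomialConv e m) S) ⟩
    a₀ + (S + binomialConv e m)
      ≡⟨ sym (+-assoc a₀ S (binomialConv e m)) ⟩
    binomialConv e (suc m) + binomialConv e m
      ≡⟨ cong (binomialConv e (suc m) +_) (sym (series-suc≡binomialConv e m)) ⟩
    binomialConv e (suc m) + (x[1+x]^ e ⊛ a) (suc m) ∎
    where
    a₀ = (e C 0) * a (suc m)
    S = sum (λ (i : Fin (suc m)) → (e C suc (toℕ i)) * a (m ∸ toℕ i))
    pascal : ∀ (i : Fin (suc m)) → (suc e C suc (toℕ i)) * a (m ∸ toℕ i)
                 ≡ (e C toℕ i) * a (m ∸ toℕ i) + (e C suc (toℕ i)) * a (m ∸ toℕ i)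
    pascal i = trans (cong (_* a (m ∸ toℕ i)) (sym (nCk+nC[k+1]≡[n+1]C[k+1] e (toℕ i))))
                     (*-distribʳ-+ (a (m ∸ toℕ i)) (e C toℕ i) (e C suc (toℕ i)))

  -- Telescoping Pascal's rule from e = 0, where x(1+x)^0 A = x A.
  binomialConv-telescope : ∀ e n →
    binomialConv e n ≡ a n + sum (λ (j : Fin e) → (x[1+x]^ (e ∸ suc (toℕ j)) ⊛ a) n)
  binomialConv-telescope zero    n = cong₂ _+_ (*-identityˡ (a n)) (sum-zero {n} (λ _ → 0) (λ _ → refl))
  binomialConv-telescope (suc e) n = begin
    binomialConv (suc e) n           ≡⟨ binomialConv-pascal e n ⟩
    binomialConv e n + s₀            ≡⟨ cong (_+ s₀) (binomialConv-telescope e n) ⟩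
    (a n + S) + s₀                   ≡⟨ +-assoc (a n) S s₀ ⟩
    a n + (S + s₀)                   ≡⟨ cong (a n +_) (+-comm S s₀) ⟩
    a n + (s₀ + S)                   ∎
    where
    s₀ = (x[1+x]^ e ⊛ a) n
    S = sum (λ (j : Fin e) → (x[1+x]^ (e ∸ suc (toℕ j)) ⊛ a) n)

  -- The recurrence (★) for the series side, with exponent k - h for the letter h.
  series-recurrence : (h : Fin k) (n : ℕ) →
    (x[1+x]^ (k ∸ suc (toℕ h)) ⊛ a) (suc n)
      ≡ a n + sumAbove h (λ t → (x[1+x]^ (k ∸ suc (toℕ t)) ⊛ a) n)
  series-recurrence {suc k} zero    n = trans (series-suc≡binomialConv k n) (binomialConv-telescope k n)
  series-recurrence {suc k} (suc h) n = series-recurrence h n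

wordSum : ∀ n → (Word k n → ℕ) → ℕ
wordSum zero    f = f []
wordSum (suc n) f = sum (λ a → wordSum n (f ∘ (a ∷_)))

𝟙 : {P : Set} → Dec P → ℕ
𝟙 (yes _) = 1
𝟙 (no _)  = 0

𝟙-yes : {P : Set} (d : Dec P) → P → 𝟙 d ≡ 1
𝟙-yes (yes _) _ = refl
𝟙-yes (no ¬p) p = ⊥-elim (¬p p)

𝟙-no : {P : Set} (d : Dec P) → ¬ P → 𝟙 d ≡ 0
𝟙-no (yes p) ¬p = ⊥-elim (¬p p)
𝟙-no (no _)  _  = refl

length-filter≡listSum : {A : Set} {P : A → Set} (P? : Decidable P) (xs : List A) →
  length (filter P? xs) ≡ listSum (map (𝟙 ∘ P?) xs)
length-filter≡listSum P? []       = refl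
length-filter≡listSum P? (x ∷ xs) with P? x
... | yes _ = cong suc (length-filter≡listSum P? xs)
... | no _  = length-filter≡listSum P? xs

listSum-concatMap-tabulate : {A B : Set} (t : Fin n → A) (g : A → List B) (f : B → ℕ) →
  listSum (map f (concatMap g (tabulate t))) ≡ sum (λ i → listSum (map f (g (t i))))
listSum-concatMap-tabulate {zero}  t g f = refl
listSum-concatMap-tabulate {suc n} t g f = begin
  listSum (map f (g (t zero) ++ rest))           ≡⟨ cong listSum (map-++ f (g (t zero)) rest) ⟩
  listSum (map f (g (t zero)) ++ map f rest)     ≡⟨ sum-++ (map f (g (t zero))) (map f rest) ⟩
  listSum (map f (g (t zero))) + listSum (map f rest)
    ≡⟨ cong (listSum (map f (g (t zero))) +_) (listSum-concatMap-tabulate (t ∘ suc) g f) ⟩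
  sum (λ i → listSum (map f (g (t i))))          ∎
  where
  rest = concatMap g (tabulate (t ∘ suc))

listSum-allWords : ∀ n (f : Word k n → ℕ) → listSum (map f (allWords k n)) ≡ wordSum n f
listSum-allWords zero    f = +-identityʳ (f [])
listSum-allWords {k} (suc n) f =
  trans (listSum-concatMap-tabulate (λ a → a) (λ a → map (a ∷_) (allWords k n)) f)
        (sum-cong-≗ λ a → trans (cong listSum (sym (map-∘ (allWords k n))))
                                (listSum-allWords n (f ∘ (a ∷_))))

count≡wordSum : ∀ n {P : Word k n → Set} (P? : Decidable P) →
  length (filter P? (allWords k n)) ≡ wordSum n (𝟙 ∘ P?)
count≡wordSum {k} n P? = trans (length-filter≡listSum P? (allWords k n)) (listSum-allWords n (𝟙 ∘ P?))

wordSum-cong : ∀ n {f g : Word k n → ℕ} → (∀ w → f w ≡ g w) → wordSum n f ≡ wordSum n g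
wordSum-cong zero    f≗g = f≗g []
wordSum-cong (suc n) f≗g = sum-cong-≗ (λ a → wordSum-cong n (f≗g ∘ (a ∷_)))

wordSum-zero : ∀ n (f : Word k n → ℕ) → (∀ w → f w ≡ 0) → wordSum n f ≡ 0
wordSum-zero zero    f f≡0 = f≡0 []
wordSum-zero (suc n) f f≡0 = sum-zero _ (λ a → wordSum-zero n (f ∘ (a ∷_)) (f≡0 ∘ (a ∷_)))

wordSum-+ : ∀ n (f g : Word k n → ℕ) → wordSum n (λ w → f w + g w) ≡ wordSum n f + wordSum n g
wordSum-+ zero    f g = refl
wordSum-+ {k} (suc n) f g =
  trans (sum-cong-≗ (λ a → wordSum-+ n (f ∘ (a ∷_)) (g ∘ (a ∷_)))) (∑-distrib-+ {k} _ _)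

wordSum-sum : ∀ n (f : Fin m → Word k n → ℕ) →
  wordSum n (λ w → sum (λ t → f t w)) ≡ sum (λ t → wordSum n (f t))
wordSum-sum zero    f = refl
wordSum-sum {m} {k} (suc n) f =
  trans (sum-cong-≗ (λ a → wordSum-sum n (λ t → f t ∘ (a ∷_)))) (∑-comm {k} {m} _)

wordSum-sumAbove : ∀ n (h : Fin m) (f : Fin m → Word k n → ℕ) →
  wordSum n (λ w → sumAbove h (λ t → f t w)) ≡ sumAbove h (λ t → wordSum n (f t))
wordSum-sumAbove n zero    f = wordSum-sum n (f ∘ suc)
wordSum-sumAbove n (suc h) f = wordSum-sumAbove n h (f ∘ suc)

wordSum-snoc : ∀ n (f : Word k (suc n) → ℕ) → wordSum (suc n) f ≡ sum (λ a → wordSum n (λ v → f (v ∷ʳ a)))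
wordSum-snoc zero    f = refl
wordSum-snoc {k} (suc n) f = begin
  sum (λ b → wordSum (suc n) (f ∘ (b ∷_)))
    ≡⟨ sum-cong-≗ (λ b → wordSum-snoc n (f ∘ (b ∷_))) ⟩
  sum (λ b → sum (λ a → wordSum n (λ v → f ((b ∷ v) ∷ʳ a))))
    ≡⟨ ∑-comm {k} {k} _ ⟩
  sum (λ a → sum (λ b → wordSum n (λ v → f ((b ∷ v) ∷ʳ a)))) ∎

lookup-inject₁ : {A : Set} (v : Vec A n) (a : A) (i : Fin n) → lookup (v ∷ʳ a) (inject₁ i) ≡ lookup v i
lookup-inject₁ (x ∷ v) a zero    = refl
lookup-inject₁ (x ∷ v) a (suc i) = lookup-inject₁ v a i

lookup-last : {A : Set} (v : Vec A n) (a : A) → lookup (v ∷ʳ a) (fromℕ n) ≡ a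
lookup-last []      a = refl
lookup-last (x ∷ v) a = lookup-last v a

last-position : (l : Fin (suc n)) → suc (toℕ l) ≡ suc n → l ≡ fromℕ n
last-position l l+1≡n+1 with view l
... | ‵fromℕ     = refl
... | ‵inject₁ i = ⊥-elim (toℕ-inject₁-≢ i (sym (ℕₚ.suc-injective l+1≡n+1)))

inject₁<fromℕ : (i : Fin n) → toℕ (inject₁ i) < toℕ (fromℕ n)
inject₁<fromℕ {n} i = subst₂ _<_ (sym (toℕ-inject₁ i)) (sym (toℕ-fromℕ n)) (toℕ<n i)

Occurs : Word k n → Fin k → Set
Occurs {n = n} w a = ∃ λ (i : Fin n) → lookup w i ≡ a

occurs? : (w : Word k n) (a : Fin k) → Dec (Occurs w a)
occurs? w a = any? (λ i → lookup w i ≟ᶠ a)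

allLetters-snoc⁺ : (v : Word k n) (a : Fin k) → AllLetters v → AllLetters (v ∷ʳ a)
allLetters-snoc⁺ v a all x with all x
... | i , vᵢ≡x = inject₁ i , trans (lookup-inject₁ v a i) vᵢ≡x

allLetters-snoc⁻ : (v : Word k n) (a : Fin k) → AllLetters (v ∷ʳ a) → Occurs v a → AllLetters v
allLetters-snoc⁻ v a all a∈v x with all x
... | j , wⱼ≡x with view j
...   | ‵fromℕ = proj₁ a∈v , trans (proj₂ a∈v) (trans (sym (lookup-last v a)) wⱼ≡x)
...   | ‵inject₁ i = i , trans (sym (lookup-inject₁ v a i)) wⱼ≡x

endsWithRepeated-snoc⁻ : (v : Word k n) (a t : Fin k) → EndsWithRepeated t (v ∷ʳ a) → a ≡ t × Occurs v t
endsWithRepeated-snoc⁻ v a t (l , l-last , wₗ≡t , i , i<l , wᵢ≡t) with last-position l l-last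
... | refl with view i
...   | ‵fromℕ = ⊥-elim (<-irrefl refl i<l)
...   | ‵inject₁ i′ = trans (sym (lookup-last v a)) wₗ≡t , i′ , trans (sym (lookup-inject₁ v a i′)) wᵢ≡t

endsWithRepeated-snoc⁺ : (v : Word k n) (a : Fin k) → Occurs v a → EndsWithRepeated a (v ∷ʳ a)
endsWithRepeated-snoc⁺ {n = n} v a (i , vᵢ≡a) =
  fromℕ n , cong suc (toℕ-fromℕ n) , lookup-last v a ,
  inject₁ i , inject₁<fromℕ i , trans (lookup-inject₁ v a i) vᵢ≡a

lastUnique-snoc⁻ : (v : Word k n) (a : Fin k) → LastUnique (v ∷ʳ a) → ¬ Occurs v a
lastUnique-snoc⁻ v a (l , l-last , unique) (i , vᵢ≡a) with last-position l l-last
... | refl = unique (inject₁ i) (fromℕ≢inject₁ ∘ sym)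
                    (trans (lookup-inject₁ v a i) (trans vᵢ≡a (sym (lookup-last v a))))

lastUnique-snoc⁺ : (v : Word k n) (a : Fin k) → ¬ Occurs v a → LastUnique (v ∷ʳ a)
lastUnique-snoc⁺ {n = n} v a a∉v = fromℕ n , cong suc (toℕ-fromℕ n) , unique
  where
  unique : (i : Fin (suc n)) → i ≢ fromℕ n → lookup (v ∷ʳ a) i ≢ lookup (v ∷ʳ a) (fromℕ n)
  unique i i≢last wᵢ≡a with view i
  ... | ‵fromℕ = i≢last refl
  ... | ‵inject₁ i′ =
    a∉v (i′ , trans (sym (lookup-inject₁ v a i′)) (trans wᵢ≡a (lookup-last v a)))

-- Appending a letter: the patterns 1-11 and 1-12

-- Occurrences of the generalized pattern 1-1x, with R relating the second 1 to x:
-- Contains1-11 is Pattern _≡_ and Contains1-12 is Pattern _<ᶠ_ (definitionally).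
Pattern : (Fin k → Fin k → Set) → Word k n → Set
Pattern {n = n} R w = ∃ λ (i : Fin n) → ∃ λ (j : Fin n) → ∃ λ (j′ : Fin n) →
  (toℕ i < toℕ j) × (toℕ j′ ≡ suc (toℕ j)) × (lookup w i ≡ lookup w j) × R (lookup w j) (lookup w j′)

_<ᶠ_ : Fin k → Fin k → Set
x <ᶠ y = toℕ x < toℕ y

PatternAtEnd : (Fin k → Fin k → Set) → Word k n → Fin k → Set
PatternAtEnd {n = n} R v a = ∃ λ (i : Fin n) → ∃ λ (j : Fin n) →
  (toℕ i < toℕ j) × (suc (toℕ j) ≡ n) × (lookup v i ≡ lookup v j) × R (lookup v j) a

pattern-snoc⁺ : (R : Fin k → Fin k → Set) (v : Word k n) (a : Fin k) → Pattern R v → Pattern R (v ∷ʳ a)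
pattern-snoc⁺ R v a (i , j , j′ , i<j , j′≡j+1 , vᵢ≡vⱼ , r) =
  inject₁ i , inject₁ j , inject₁ j′ ,
  subst₂ _<_ (sym (toℕ-inject₁ i)) (sym (toℕ-inject₁ j)) i<j ,
  trans (toℕ-inject₁ j′) (trans j′≡j+1 (cong suc (sym (toℕ-inject₁ j)))) ,
  trans (lookup-inject₁ v a i) (trans vᵢ≡vⱼ (sym (lookup-inject₁ v a j))) ,
  subst₂ R (sym (lookup-inject₁ v a j)) (sym (lookup-inject₁ v a j′)) r

patternAtEnd⇒pattern : (R : Fin k → Fin k → Set) (v : Word k n) (a : Fin k) →
  PatternAtEnd R v a → Pattern R (v ∷ʳ a)
patternAtEnd⇒pattern {n = n} R v a (i , j , i<j , j-last , vᵢ≡vⱼ , r) =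
  inject₁ i , inject₁ j , fromℕ n ,
  subst₂ _<_ (sym (toℕ-inject₁ i)) (sym (toℕ-inject₁ j)) i<j ,
  trans (toℕ-fromℕ n) (trans (sym j-last) (cong suc (sym (toℕ-inject₁ j)))) ,
  trans (lookup-inject₁ v a i) (trans vᵢ≡vⱼ (sym (lookup-inject₁ v a j))) ,
  subst₂ R (sym (lookup-inject₁ v a j)) (sym (lookup-last v a)) r

pattern-snoc⁻ : (R : Fin k → Fin k → Set) (v : Word k n) (a : Fin k) →
  Pattern R (v ∷ʳ a) → Pattern R v ⊎ PatternAtEnd R v a
pattern-snoc⁻ {n = n} R v a (i , j , j′ , i<j , j′≡j+1 , wᵢ≡wⱼ , r) with view j
... | ‵fromℕ = ⊥-elim (<-irrefl refl (subst (_< suc n) (trans j′≡j+1 (cong suc (toℕ-fromℕ n))) (toℕ<n j′)))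
... | ‵inject₁ j₀ with view i
...   | ‵fromℕ = ⊥-elim (<-asym (subst₂ _<_ (toℕ-fromℕ n) (toℕ-inject₁ j₀) i<j) (toℕ<n j₀))
...   | ‵inject₁ i₀ with view j′
...     | ‵inject₁ j₀′ = inj₁ (i₀ , j₀ , j₀′ , i₀<j₀ ,
            trans (sym (toℕ-inject₁ j₀′)) (trans j′≡j+1 (cong suc (toℕ-inject₁ j₀))) ,
            vᵢ≡vⱼ , subst₂ R (lookup-inject₁ v a j₀) (lookup-inject₁ v a j₀′) r)
  where
  i₀<j₀ = subst₂ _<_ (toℕ-inject₁ i₀) (toℕ-inject₁ j₀) i<j
  vᵢ≡vⱼ = trans (sym (lookup-inject₁ v a i₀)) (trans wᵢ≡wⱼ (lookup-inject₁ v a j₀))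
...     | ‵fromℕ = inj₂ (i₀ , j₀ , i₀<j₀ ,
            trans (cong suc (sym (toℕ-inject₁ j₀))) (trans (sym j′≡j+1) (toℕ-fromℕ n)) ,
            vᵢ≡vⱼ , subst₂ R (lookup-inject₁ v a j₀) (lookup-last v a) r)
  where
  i₀<j₀ = subst₂ _<_ (toℕ-inject₁ i₀) (toℕ-inject₁ j₀) i<j
  vᵢ≡vⱼ = trans (sym (lookup-inject₁ v a i₀)) (trans wᵢ≡wⱼ (lookup-inject₁ v a j₀))

patternAtEnd-snoc⁻ : (R : Fin k → Fin k → Set) (u : Word k m) (b a : Fin k) →
  PatternAtEnd R (u ∷ʳ b) a → Occurs u b × R b a
patternAtEnd-snoc⁻ R u b a (i , j , i<j , j-last , vᵢ≡vⱼ , r) with last-position j j-last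
... | refl with view i
...   | ‵fromℕ = ⊥-elim (<-irrefl refl i<j)
...   | ‵inject₁ i′ = (i′ , trans (sym (lookup-inject₁ u b i′)) (trans vᵢ≡vⱼ (lookup-last u b))) ,
                      subst (λ x → R x a) (lookup-last u b) r

patternAtEnd-snoc⁺ : (R : Fin k → Fin k → Set) (u : Word k m) (b a : Fin k) →
  Occurs u b → R b a → PatternAtEnd R (u ∷ʳ b) a
patternAtEnd-snoc⁺ {m = m} R u b a (i , uᵢ≡b) r =
  inject₁ i , fromℕ m , inject₁<fromℕ i , cong suc (toℕ-fromℕ m) ,
  trans (lookup-inject₁ u b i) (trans uᵢ≡b (sym (lookup-last u b))) ,
  subst (λ x → R x a) (sym (lookup-last u b)) r

Avoids : Word k n → Set
Avoids w = ¬ Contains1-11 w × ¬ Contains1-12 w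

avoids-snoc⁻ : (u : Word k m) (b a : Fin k) →
  Avoids (u ∷ʳ b ∷ʳ a) → Avoids (u ∷ʳ b) × (Occurs u b → toℕ a < toℕ b)
avoids-snoc⁻ {k = k} u b a (no11 , no12) =
  (no11 ∘ pattern-snoc⁺ _≡_ (u ∷ʳ b) a , no12 ∘ pattern-snoc⁺ _<ᶠ_ (u ∷ʳ b) a) , a<b
  where
  newPattern : (R : Fin k → Fin k → Set) → Occurs u b → R b a → Pattern R (u ∷ʳ b ∷ʳ a)
  newPattern R b∈u r = patternAtEnd⇒pattern R (u ∷ʳ b) a (patternAtEnd-snoc⁺ R u b a b∈u r)
  a<b : Occurs u b → toℕ a < toℕ b
  a<b b∈u with <-cmp (toℕ a) (toℕ b)
  ... | tri< a<b _ _ = a<b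
  ... | tri≈ _ a≡b _ = ⊥-elim (no11 (newPattern _≡_ b∈u (toℕ-injective (sym a≡b))))
  ... | tri> _ _ b<a = ⊥-elim (no12 (newPattern _<ᶠ_ b∈u b<a))

avoids-snoc⁺ : (u : Word k m) (b a : Fin k) →
  Avoids (u ∷ʳ b) → (Occurs u b → toℕ a < toℕ b) → Avoids (u ∷ʳ b ∷ʳ a)
avoids-snoc⁺ {k = k} u b a (no11 , no12) a<b =
  noNew _≡_ (λ b≡a → <-irrefl (cong toℕ (sym b≡a))) no11 ,
  noNew _<ᶠ_ (λ b<a a<b → <-asym a<b b<a) no12
  where
  noNew : (R : Fin k → Fin k → Set) → (R b a → ¬ toℕ a < toℕ b) →
    ¬ Pattern R (u ∷ʳ b) → ¬ Pattern R (u ∷ʳ b ∷ʳ a)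
  noNew R incompatible noOld p with pattern-snoc⁻ R (u ∷ʳ b) a p
  ... | inj₁ old = noOld old
  ... | inj₂ atEnd with patternAtEnd-snoc⁻ R u b a atEnd
  ...   | b∈u , r = incompatible r (a<b b∈u)

isCh-last : (v : Word k n) (a t : Fin k) → IsCh t (v ∷ʳ a) → a ≡ t
isCh-last v a t (_ , _ , _ , ends) = proj₁ (endsWithRepeated-snoc⁻ v a t ends)

isC⇒¬isCh : (v : Word k n) (b t : Fin k) → IsC (v ∷ʳ b) → ¬ IsCh t (v ∷ʳ b)
isC⇒¬isCh v b t (_ , _ , _ , unique) (_ , _ , _ , ends) with endsWithRepeated-snoc⁻ v b t ends
... | refl , b∈v = lastUnique-snoc⁻ v b unique b∈v

¬isC-[] : ¬ IsC {k} []
¬isC-[] (_ , _ , _ , () , _)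

¬isCh-[] : (t : Fin k) → ¬ IsCh t []
¬isCh-[] t (_ , _ , _ , () , _)

¬isCh-[a] : (a t : Fin k) → ¬ IsCh t ([] ∷ʳ a)
¬isCh-[a] a t (_ , _ , _ , ends) with endsWithRepeated-snoc⁻ [] a t ends
... | _ , () , _

isCh-snoc⁺ : (u : Word k m) (b h : Fin k) → AllLetters (u ∷ʳ b) → Avoids (u ∷ʳ b) →
  (Occurs u b → toℕ h < toℕ b) → IsCh h (u ∷ʳ b ∷ʳ h)
isCh-snoc⁺ u b h all avoids h<b =
  allLetters-snoc⁺ (u ∷ʳ b) h all , proj₁ avoids′ , proj₂ avoids′ ,
  endsWithRepeated-snoc⁺ (u ∷ʳ b) h (all h)
  where avoids′ = avoids-snoc⁺ u b h avoids h<b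

isCh-snoc⁻ : (u : Word k m) (b h : Fin k) →
  IsCh h (u ∷ʳ b ∷ʳ h) → IsC (u ∷ʳ b) ⊎ (toℕ h < toℕ b × IsCh b (u ∷ʳ b))
isCh-snoc⁻ u b h (all , no11 , no12 , ends)
  with allLetters-snoc⁻ (u ∷ʳ b) h all (proj₂ (endsWithRepeated-snoc⁻ (u ∷ʳ b) h h ends))
     | avoids-snoc⁻ u b h (no11 , no12) | occurs? u b
... | all′ | (no11′ , no12′) , h<b | yes b∈u =
  inj₂ (h<b b∈u , all′ , no11′ , no12′ , endsWithRepeated-snoc⁺ u b b∈u)
... | all′ | (no11′ , no12′) , _   | no b∉u  =
  inj₁ (all′ , no11′ , no12′ , lastUnique-snoc⁺ u b b∉u)

-- The counting recurrence (★)

-- Pointwise form of (★): [v h counted by c^(h)] = [v counted by c] + Σ_{t > h} [v counted by c^(t)].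
PointwiseRecurrence : Word k n → Fin k → Set
PointwiseRecurrence v h = 𝟙 (isCh? h (v ∷ʳ h)) ≡ 𝟙 (isC? v) + sumAbove h (λ t → 𝟙 (isCh? t v))

pointwise-[] : (h : Fin k) → PointwiseRecurrence [] h
pointwise-[] h = begin
  𝟙 (isCh? h ([] ∷ʳ h))                           ≡⟨ 𝟙-no _ (¬isCh-[a] h h) ⟩
  0                                               ≡⟨ sumAbove-zero h S (λ t _ → 𝟙-no _ (¬isCh-[] t)) ⟨
  sumAbove h S                                    ≡⟨ cong (_+ sumAbove h S) (𝟙-no (isC? []) ¬isC-[]) ⟨
  𝟙 (isC? []) + sumAbove h S                      ∎
  where S = λ t → 𝟙 (isCh? t [])

pointwise-isC : (u : Word k m) (b h : Fin k) → IsC (u ∷ʳ b) → PointwiseRecurrence (u ∷ʳ b) h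
pointwise-isC u b h isC@(all , no11 , no12 , unique) = begin
  𝟙 (isCh? h (u ∷ʳ b ∷ʳ h))
    ≡⟨ 𝟙-yes _ (isCh-snoc⁺ u b h all (no11 , no12) (⊥-elim ∘ lastUnique-snoc⁻ u b unique)) ⟩
  1 + 0
    ≡⟨ cong₂ _+_ (𝟙-yes (isC? (u ∷ʳ b)) isC) (sumAbove-zero h _ (λ t _ → 𝟙-no _ (isC⇒¬isCh u b t isC))) ⟨
  𝟙 (isC? (u ∷ʳ b)) + sumAbove h (λ t → 𝟙 (isCh? t (u ∷ʳ b))) ∎

-- Case v h counted by c^(h) but v not by c: then v is counted by c^(b) for its
-- last letter b > h, and by no other c^(t).
pointwise-isCh : (u : Word k m) (b h : Fin k) → ¬ IsC (u ∷ʳ b) → IsCh h (u ∷ʳ b ∷ʳ h) →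
  PointwiseRecurrence (u ∷ʳ b) h
pointwise-isCh u b h ¬isC isCh = fromCases (isCh-snoc⁻ u b h isCh)
  where
  fromCases : IsC (u ∷ʳ b) ⊎ (toℕ h < toℕ b × IsCh b (u ∷ʳ b)) → PointwiseRecurrence (u ∷ʳ b) h
  fromCases (inj₁ isC) = ⊥-elim (¬isC isC)
  fromCases (inj₂ (h<b , isChᵦ)) = begin
    𝟙 (isCh? h (u ∷ʳ b ∷ʳ h))  ≡⟨ 𝟙-yes (isCh? h (u ∷ʳ b ∷ʳ h)) isCh ⟩
    1                          ≡⟨ 𝟙-yes (isCh? b (u ∷ʳ b)) isChᵦ ⟨
    𝟙 (isCh? b (u ∷ʳ b))       ≡⟨ sumAbove-single h b S h<b (λ t t≢b → 𝟙-no _ (t≢b ∘ sym ∘ isCh-last u b t)) ⟨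
    sumAbove h S               ≡⟨ cong (_+ sumAbove h S) (𝟙-no (isC? (u ∷ʳ b)) ¬isC) ⟨
    𝟙 (isC? (u ∷ʳ b)) + sumAbove h S ∎
    where S = λ t → 𝟙 (isCh? t (u ∷ʳ b))

pointwise-neither : (u : Word k m) (b h : Fin k) → ¬ IsC (u ∷ʳ b) → ¬ IsCh h (u ∷ʳ b ∷ʳ h) →
  PointwiseRecurrence (u ∷ʳ b) h
pointwise-neither u b h ¬isC ¬isCh = begin
  𝟙 (isCh? h (u ∷ʳ b ∷ʳ h))  ≡⟨ 𝟙-no _ ¬isCh ⟩
  0 + 0
    ≡⟨ cong₂ _+_ (𝟙-no (isC? (u ∷ʳ b)) ¬isC) (sumAbove-zero h _ (λ t h<t → 𝟙-no _ (vanish t h<t))) ⟨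
  𝟙 (isC? (u ∷ʳ b)) + sumAbove h (λ t → 𝟙 (isCh? t (u ∷ʳ b))) ∎
  where
  -- a letter t > h with v counted by c^(t) would make v h counted by c^(h)
  vanish : ∀ t → toℕ h < toℕ t → ¬ IsCh t (u ∷ʳ b)
  vanish t h<t isChₜ@(all , no11 , no12 , _) with isCh-last u b t isChₜ
  ... | refl = ¬isCh (isCh-snoc⁺ u b h all (no11 , no12) (λ _ → h<t))

pointwise-∷ʳ : (u : Word k m) (b h : Fin k) → PointwiseRecurrence (u ∷ʳ b) h
pointwise-∷ʳ u b h = byCases (isC? (u ∷ʳ b)) (isCh? h (u ∷ʳ b ∷ʳ h))
  where
  byCases : Dec (IsC (u ∷ʳ b)) → Dec (IsCh h (u ∷ʳ b ∷ʳ h)) → PointwiseRecurrence (u ∷ʳ b) h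
  byCases (yes isC) _          = pointwise-isC u b h isC
  byCases (no ¬isC) (yes isCh) = pointwise-isCh u b h ¬isC isCh
  byCases (no ¬isC) (no ¬isCh) = pointwise-neither u b h ¬isC ¬isCh

pointwise : (v : Word k n) (h : Fin k) → PointwiseRecurrence v h
pointwise {n = zero}  [] h = pointwise-[] h
pointwise {n = suc m} v  h = fromInitLast (initLast v)
  where
  fromInitLast : ∃₂ (λ u b → v ≡ u ∷ʳ b) → PointwiseRecurrence v h
  fromInitLast (u , b , v≡u∷ʳb) = subst (λ w → PointwiseRecurrence w h) (sym v≡u∷ʳb) (pointwise-∷ʳ u b h)

ch-zero : ∀ k (h : Fin k) → ch k h 0 ≡ 0
ch-zero k h = trans (count≡wordSum 0 (isCh? h)) (𝟙-no (isCh? h []) (¬isCh-[] h))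

ch-suc : ∀ k (h : Fin k) n → ch k h (suc n) ≡ c k n + sumAbove h (λ t → ch k t n)
ch-suc k h n = begin
  ch k h (suc n)
    ≡⟨ count≡wordSum (suc n) (isCh? h) ⟩
  wordSum (suc n) (𝟙 ∘ isCh? h)
    ≡⟨ wordSum-snoc n (𝟙 ∘ isCh? h) ⟩
  sum (λ a → wordSum n (λ v → 𝟙 (isCh? h (v ∷ʳ a))))
    ≡⟨ sum-single _ h (λ a a≢h → wordSum-zero n _ (λ v → 𝟙-no _ (a≢h ∘ isCh-last v a h))) ⟩
  wordSum n (λ v → 𝟙 (isCh? h (v ∷ʳ h)))
    ≡⟨ wordSum-cong n (λ v → pointwise v h) ⟩
  wordSum n (λ v → 𝟙 (isC? v) + sumAbove h (λ t → 𝟙 (isCh? t v)))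
    ≡⟨ wordSum-+ n _ _ ⟩
  wordSum n (𝟙 ∘ isC?) + wordSum n (λ v → sumAbove h (λ t → 𝟙 (isCh? t v)))
    ≡⟨ cong (wordSum n (𝟙 ∘ isC?) +_) (wordSum-sumAbove n h _) ⟩
  wordSum n (𝟙 ∘ isC?) + sumAbove h (λ t → wordSum n (𝟙 ∘ isCh? t))
    ≡⟨ cong₂ _+_ (count≡wordSum n isC?) (sumAbove-cong h (λ t → count≡wordSum n (isCh? t))) ⟨
  c k n + sumAbove h (λ t → ch k t n) ∎

mainTheorem9 : (k : ℕ) (h : Fin k) (n : ℕ) →
    ch k h n ≡ (x[1+x]^ (k ∸ suc (toℕ h)) ⊛ c k) n
mainTheorem9 k h zero    = ch-zero k h
mainTheorem9 k h (suc n) = begin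
  ch k h (suc n)
    ≡⟨ ch-suc k h n ⟩
  c k n + sumAbove h (λ t → ch k t n)
    ≡⟨ cong (c k n +_) (sumAbove-cong h (λ t → mainTheorem9 k t n)) ⟩
  c k n + sumAbove h (λ t → (x[1+x]^ (k ∸ suc (toℕ t)) ⊛ c k) n)
    ≡⟨ series-recurrence (c k) h n ⟨
  (x[1+x]^ (k ∸ suc (toℕ h)) ⊛ c k) (suc n) ∎
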